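{- There is an absolute constant $C>0$ such that the following holds. Let $G$ be a strongly connected simple directed graph on $n$ vertices with orbit $b=b(G)$, let $f$ be any valuation of $G$, and let $X$ be the number of rounds of the asynchronous maximum model started at $f$ until a strong cycle is formed (i.e., until the first time the current valuation has a strong cycle). Then $\mathbb{E}[X]\le C\,n b^2$, i.e. $\mathbb{E}[X]=\mathcal{O}(nb^2)$.
   Context: Let $G=(V,E)$ be a finite simple directed graph with $n=|V|$ vertices and $[n]=\{1,\dots,n\}$. A valuation is a function $f:V\to[n]$. The asynchronous maximum model: given the current valuation $f_t$, choose $v'\in V$ uniformly at random, independently of the past; set $f_{t+1}(v')=\max\{f_t(u): u\neq v',\ (v',u)\in E\}$ if $v'$ has at least one out-neighbour and $f_{t+1}(v')=f_t(v')$ otherwise, and $f_{t+1}(v)=f_t(v)$ for $v\neq v'$. Each step is a round. Let $M_t=\max_v f_t(v)$. A strong cycle for $f_t$ is a directed cycle $v_1,v_2,\dots,v_k,v_1$ of distinct vertices ($(v_i,v_{i+1})\in E$ for $i<k$ and $(v_k,v_1)\in E$) with $f_t(v_i)=M_t$ for all $i$. For $v\in V$, $b(v)$ is the length of a shortest directed cycle containing $v$; the orbit of $G$ is $b(G)=\max_{v\in V} b(v)$. -}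

module Defs where

open import Data.Nat using (ℕ; zero; suc; _+_; _*_; _∸_; _^_; _≤_; _<_; _⊔_)
open import Data.Fin using (Fin; _≟_)
open import Data.List using (List; []; _∷_; _++_; map; foldr; filter; length; concatMap; inits; upTo)
open import Data.Nat.ListAction using (sum)
open import Data.List.Membership.Propositional using (_∈_)
open import Data.List.Relation.Unary.All using (All; all?)
open import Data.List.Relation.Unary.Unique.Propositional using (Unique)
open import Data.List.Relation.Unary.Linked using (Linked)
open import Data.Bool using (Bool; true; false; _∧_; not)
open import Data.Product using (Σ; ∃; _×_; _,_)
open import Data.Empty using (⊥)
open import Relation.Nullary using (Dec; ¬_; yes; no)
open import Relation.Nullary.Decidable using (¬?; ⌊_⌋)
open import Relation.Binary.PropositionalEquality using (_≡_)
import Data.List as L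

Graph : ℕ → Set
Graph n = Fin n → Fin n → Bool

Edge : ∀ {n} → Graph n → Fin n → Fin n → Set
Edge G u v = G u v ≡ true

-- simple directed graph: no loops (no multi-edges is automatic)
Loopless : ∀ {n} → Graph n → Set
Loopless G = ∀ v → G v v ≡ false

data Path {n} (G : Graph n) : Fin n → Fin n → Set where
  here : ∀ {u} → Path G u u
  step : ∀ {u w v} → Edge G u w → Path G w v → Path G u v

StronglyConnected : ∀ {n} → Graph n → Set
StronglyConnected G = ∀ u v → Path G u v

-- a directed cycle v1 … vk v1 of distinct vertices, given as the list v1 … vk
IsCycle : ∀ {n} → Graph n → List (Fin n) → Set
IsCycle G [] = ⊥
IsCycle G (x ∷ xs) = Unique (x ∷ xs) × Linked (Edge G) ((x ∷ xs) ++ (x ∷ []))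

ShortestCycleLength : ∀ {n} → Graph n → Fin n → ℕ → Set
ShortestCycleLength G v k =
  (∃ λ c → IsCycle G c × v ∈ c × length c ≡ k) ×
  (∀ c → IsCycle G c → v ∈ c → k ≤ length c)

-- b(G) = b : the orbit is the maximum over v of b(v)
IsOrbit : ∀ {n} → Graph n → ℕ → Set
IsOrbit G b =
  (∀ v → ∃ λ k → ShortestCycleLength G v k × k ≤ b) ×
  (∃ λ v → ShortestCycleLength G v b)

-- valuations (values are natural numbers; the range [n] is imposed as a hypothesis)
Valuation : ℕ → Set
Valuation n = Fin n → ℕ

ValidValuation : ∀ n → Valuation n → Set
ValidValuation n f = ∀ v → 1 ≤ f v × f v ≤ n

maxList : List ℕ → ℕ
maxList = foldr _⊔_ 0

outValues : ∀ {n} → Graph n → Valuation n → Fin n → List ℕ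
outValues {n} G f v =
  map f (filter (λ u → (G v u ∧ not ⌊ u ≟ v ⌋) B.≟ true) (L.allFin n))
  where import Data.Bool as B

update : ∀ {n} → Graph n → Valuation n → Fin n → Valuation n
update G f v' v with ⌊ v ≟ v' ⌋ | outValues G f v'
... | false | _ = f v
... | true  | [] = f v
... | true  | (x ∷ xs) = maxList (x ∷ xs)

run : ∀ {n} → Graph n → Valuation n → List (Fin n) → Valuation n
run G f [] = f
run G f (v ∷ vs) = run G (update G f v) vs

maxVal : ∀ {n} → Valuation n → ℕ
maxVal {n} g = maxList (map g (L.allFin n))

HasStrongCycle : ∀ {n} → Graph n → Valuation n → Set
HasStrongCycle G g = ∃ λ c → IsCycle G c × All (λ v → g v ≡ maxVal g) c

-- all sequences of t choices from Fin n (each equally likely, probability n^-t)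
sequences : ∀ n → ℕ → List (List (Fin n))
sequences n zero = [] ∷ []
sequences n (suc t) = concatMap (λ v → map (v ∷_) (sequences n t)) (L.allFin n)

-- number of choice sequences of length t along which no strong cycle exists at
-- any time 0,…,t, i.e.  n^t · P(X > t).  Parametrised by a decision procedure.
survivors : ∀ {n} (G : Graph n) (f : Valuation n) →
            (∀ g → Dec (HasStrongCycle G g)) → ℕ → ℕ
survivors {n} G f d t =
  length (filter (λ s → all? (λ p → ¬? (d (run G f p))) (inits s)) (sequences n t))

-- n^T · Σ_{t<T} P(X > t)  =  Σ_{t<T} survivors t · n^(T ∸ t)
scaledPartialExpectation : ∀ {n} (G : Graph n) (f : Valuation n) →
            (∀ g → Dec (HasStrongCycle G g)) → ℕ → ℕ
scaledPartialExpectation {n} G f d T =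
  sum (map (λ t → survivors G f d t * n ^ (T ∸ t)) (upTo T))

-- Fix a cycle C of length at most b through a vertex of maximal value M, and let x be the number of
-- vertices of C holding M.  Updating a vertex of C whose successor holds M makes it hold M, and x
-- can only drop at a vertex holding M whose successor does not.  Going around C the rises and falls
-- of "holds M" balance, and while 0 < x < |C| there is at least one of each, so by convexity the
-- potential n·x² grows by at least 1 per round in expectation until C is a strong cycle.  It is
-- bounded by n·b², so E[X] ≤ n·b²; when M disappears from C, a cycle through a new maximal vertex
-- takes over.

module Submission where

open import Defs
open import Data.Nat using (ℕ; zero; suc; _+_; _*_; _∸_; _^_; _≤_; _<_; _≡ᵇ_; z≤n; s≤s)
open import Data.Nat.Properties hiding (_≟_)
open import Data.Nat.ListAction using (sum)
open import Data.Nat.Tactic.RingSolver using (solve-∀)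
open import Data.Bool using (Bool; true; false; _∧_; not)
import Data.Bool as Bool
open import Data.Bool.Properties using (T-≡)
open import Function.Bundles using (Equivalence)
open import Data.List using (List; []; _∷_; _++_; map; concatMap; filter; length; inits; upTo; tabulate; allFin)
open import Data.List.Properties using (map-∘; map-++; map-tabulate; map-applyUpTo; length-tabulate)
open import Data.Nat.ListAction.Properties using (sum-++)
open import Data.List.Relation.Unary.All as All using (All; all?; []; _∷_)
open import Data.List.Relation.Unary.AllPairs using ([]; _∷_)
open import Data.List.Relation.Unary.Unique.Propositional using (Unique)
open import Data.List.Relation.Unary.Linked using (Linked; _∷_)
open import Data.List.Relation.Unary.Any using (here; there)
open import Data.List.Membership.Propositional using (_∈_; _∉_)
open import Data.List.Membership.Propositional.Properties using (∈-map⁺; ∈-filter⁺; ∈-allFin)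
open import Data.Product using (Σ; ∃; _×_; _,_; proj₁; proj₂)
open import Data.Empty using (⊥; ⊥-elim)
open import Data.Sum using (inj₁; inj₂)
open import Relation.Nullary using (Dec; yes; no; does; ¬_)
open import Relation.Nullary.Decidable using (¬?; ⌊_⌋; dec-true; dec-false)
open import Relation.Binary.PropositionalEquality
open import Function using (_∘_; id)
open import Data.Fin using (Fin; _≟_)
import Data.Fin as Fin

private variable A B : Set

sum-map-cong : {f g : A → ℕ} → (∀ x → f x ≡ g x) → ∀ xs → sum (map f xs) ≡ sum (map g xs)
sum-map-cong f≗g []       = refl
sum-map-cong f≗g (x ∷ xs) = cong₂ _+_ (f≗g x) (sum-map-cong f≗g xs)

sum-map-mono : {f g : A → ℕ} → (∀ x → f x ≤ g x) → ∀ xs → sum (map f xs) ≤ sum (map g xs)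
sum-map-mono f≤g []       = z≤n
sum-map-mono f≤g (x ∷ xs) = +-mono-≤ (f≤g x) (sum-map-mono f≤g xs)

sum-map-const : ∀ c (xs : List A) → sum (map (λ _ → c) xs) ≡ length xs * c
sum-map-const c []       = refl
sum-map-const c (x ∷ xs) = cong (c +_) (sum-map-const c xs)

sum-map-zero : {f : A → ℕ} → (∀ x → f x ≡ 0) → ∀ xs → sum (map f xs) ≡ 0
sum-map-zero f≗0 xs = trans (sum-map-cong f≗0 xs) (trans (sum-map-const 0 xs) (*-zeroʳ (length xs)))

sum-map-+ : ∀ (f g : A → ℕ) xs → sum (map (λ x → f x + g x) xs) ≡ sum (map f xs) + sum (map g xs)
sum-map-+ f g []       = refl
sum-map-+ f g (x ∷ xs) = begin
  f x + g x + sum (map (λ x → f x + g x) xs)       ≡⟨ cong (f x + g x +_) (sum-map-+ f g xs) ⟩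
  f x + g x + (sum (map f xs) + sum (map g xs))    ≡⟨ +-assoc-swap (f x) (g x) _ _ ⟩
  f x + sum (map f xs) + (g x + sum (map g xs))    ∎
  where
  open ≡-Reasoning
  +-assoc-swap : ∀ a b c e → (a + b) + (c + e) ≡ (a + c) + (b + e)
  +-assoc-swap = solve-∀

sum-map-*ʳ : ∀ (f : A → ℕ) c xs → sum (map (λ x → f x * c) xs) ≡ sum (map f xs) * c
sum-map-*ʳ f c []       = refl
sum-map-*ʳ f c (x ∷ xs) = trans (cong (f x * c +_) (sum-map-*ʳ f c xs)) (sym (*-distribʳ-+ c (f x) _))

sum-map-*ˡ : ∀ c (f : A → ℕ) xs → sum (map (λ x → c * f x) xs) ≡ c * sum (map f xs)
sum-map-*ˡ c f []       = sym (*-zeroʳ c)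
sum-map-*ˡ c f (x ∷ xs) = trans (cong (c * f x +_) (sum-map-*ˡ c f xs)) (sym (*-distribˡ-+ c (f x) _))

sum-map-swap : ∀ (F : A → B → ℕ) xs ys →
  sum (map (λ y → sum (map (λ x → F x y) xs)) ys) ≡ sum (map (λ x → sum (map (F x) ys)) xs)
sum-map-swap F xs []       = sym (sum-map-zero (λ _ → refl) xs)
sum-map-swap F xs (y ∷ ys) =
  trans (cong (sum (map (λ x → F x y) xs) +_) (sum-map-swap F xs ys))
        (sym (sum-map-+ (λ x → F x y) (λ x → sum (map (F x) ys)) xs))

sum-map-concatMap : ∀ (f : B → ℕ) (g : A → List B) xs →
  sum (map f (concatMap g xs)) ≡ sum (map (λ x → sum (map f (g x))) xs)
sum-map-concatMap f g []       = refl
sum-map-concatMap f g (x ∷ xs) = begin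
  sum (map f (g x ++ concatMap g xs))                 ≡⟨ cong sum (map-++ f (g x) _) ⟩
  sum (map f (g x) ++ map f (concatMap g xs))         ≡⟨ sum-++ (map f (g x)) _ ⟩
  sum (map f (g x)) + sum (map f (concatMap g xs))    ≡⟨ cong (sum (map f (g x)) +_) (sum-map-concatMap f g xs) ⟩
  sum (map f (g x)) + sum (map (λ x → sum (map f (g x))) xs) ∎
  where open ≡-Reasoning

sum-map-+-*ʳ : ∀ (f U D : A → ℕ) a b xs →
  sum (map (λ v → f v + U v * a + D v * b) xs) ≡ sum (map f xs) + sum (map U xs) * a + sum (map D xs) * b
sum-map-+-*ʳ f U D a b xs = begin
  sum (map (λ v → f v + U v * a + D v * b) xs)
    ≡⟨ sum-map-+ (λ v → f v + U v * a) (λ v → D v * b) xs ⟩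
  sum (map (λ v → f v + U v * a) xs) + sum (map (λ v → D v * b) xs)
    ≡⟨ cong₂ _+_ (sum-map-+ f (λ v → U v * a) xs) (sum-map-*ʳ D b xs) ⟩
  sum (map f xs) + sum (map (λ v → U v * a) xs) + sum (map D xs) * b
    ≡⟨ cong (λ s → sum (map f xs) + s + sum (map D xs) * b) (sum-map-*ʳ U a xs) ⟩
  sum (map f xs) + sum (map U xs) * a + sum (map D xs) * b
    ∎
  where open ≡-Reasoning

∑ : ∀ {n} → (Fin n → ℕ) → ℕ
∑ {n} f = sum (map f (allFin n))

sum-allFin-const : ∀ n c → ∑ {n} (λ _ → c) ≡ n * c
sum-allFin-const n c = trans (sum-map-const c (allFin n)) (cong (_* c) (length-tabulate {n = n} id))

boolToℕ : Bool → ℕ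
boolToℕ true  = 1
boolToℕ false = 0

count : (A → Bool) → List A → ℕ
count p xs = sum (map (boolToℕ ∘ p) xs)

length-filter≡count : {P : A → Set} (P? : ∀ x → Dec (P x)) (xs : List A) →
  length (filter P? xs) ≡ count (does ∘ P?) xs
length-filter≡count P? []       = refl
length-filter≡count P? (x ∷ xs) with does (P? x)
... | true  = cong suc (length-filter≡count P? xs)
... | false = length-filter≡count P? xs

does-all?-map : {P : B → Set} (P? : ∀ y → Dec (P y)) (h : A → B) (xs : List A) →
  does (all? P? (map h xs)) ≡ does (all? (P? ∘ h) xs)
does-all?-map P? h []       = refl
does-all?-map P? h (x ∷ xs) = cong (does (P? (h x)) ∧_) (does-all?-map P? h xs)

module _ (p : A → Bool) where

  count-≤-length : ∀ xs → count p xs ≤ length xs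
  count-≤-length []       = z≤n
  count-≤-length (x ∷ xs) with p x
  ... | true  = s≤s (count-≤-length xs)
  ... | false = m≤n⇒m≤1+n (count-≤-length xs)

  count≡length⇒All : ∀ xs → count p xs ≡ length xs → All (λ x → p x ≡ true) xs
  count≡length⇒All []       _  = []
  count≡length⇒All (x ∷ xs) eq with p x in px
  ... | true  = px ∷ count≡length⇒All xs (suc-injective eq)
  ... | false = ⊥-elim (<-irrefl eq (s≤s (count-≤-length xs)))

  All⇒count≡length : ∀ xs → All (λ x → p x ≡ true) xs → count p xs ≡ length xs
  All⇒count≡length []       []         = refl
  All⇒count≡length (x ∷ xs) (px ∷ pxs) rewrite px = cong suc (All⇒count≡length xs pxs)

  count-positive : ∀ {x} xs → x ∈ xs → p x ≡ true → 1 ≤ count p xs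
  count-positive (y ∷ ys) (here refl) px rewrite px = s≤s z≤n
  count-positive (y ∷ ys) (there x∈)  px = ≤-trans (count-positive ys x∈ px) (m≤n+m _ _)

count-mono : {p p′ : A → Bool} → (∀ x → p x ≡ true → p′ x ≡ true) → ∀ xs → count p xs ≤ count p′ xs
count-mono {p = p} {p′} p⇒p′ []       = z≤n
count-mono {p = p} {p′} p⇒p′ (x ∷ xs) = +-mono-≤ (pointwise (p x) refl) (count-mono p⇒p′ xs)
  where
  pointwise : ∀ b → p x ≡ b → boolToℕ b ≤ boolToℕ (p′ x)
  pointwise true  px rewrite p⇒p′ x px = ≤-refl
  pointwise false _  = z≤n

All-not⇒count≡0 : (p : A → Bool) → ∀ xs → All (λ x → not (p x) ≡ true) xs → count p xs ≡ 0
All-not⇒count≡0 p []       []          = refl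
All-not⇒count≡0 p (x ∷ xs) (npx ∷ npxs) with p x
... | false = All-not⇒count≡0 p xs npxs

module _ {v : A} {p p′ : A → Bool} (agree : ∀ c → c ≢ v → p′ c ≡ p c) where

  count-agree-∉ : ∀ xs → v ∉ xs → count p′ xs ≡ count p xs
  count-agree-∉ []       _   = refl
  count-agree-∉ (x ∷ xs) v∉ =
    cong₂ _+_ (cong boolToℕ (agree x (λ x≡v → v∉ (here (sym x≡v))))) (count-agree-∉ xs (v∉ ∘ there))

  count-agree-∈ : ∀ xs → Unique xs → v ∈ xs → count p′ xs + boolToℕ (p v) ≡ count p xs + boolToℕ (p′ v)
  count-agree-∈ (x ∷ xs) (x∉xs ∷ _) (here refl)
    rewrite count-agree-∉ xs (λ x∈ → All.lookup x∉xs x∈ refl) = swap (boolToℕ (p′ x)) (count p xs) (boolToℕ (p x))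
    where
    swap : ∀ a c e → a + c + e ≡ e + c + a
    swap = solve-∀
  count-agree-∈ (x ∷ xs) (x∉xs ∷ unique) (there v∈)
    rewrite agree x (All.lookup x∉xs v∈) =
      trans (+-assoc (boolToℕ (p x)) (count p′ xs) (boolToℕ (p v)))
            (trans (cong (boolToℕ (p x) +_) (count-agree-∈ xs unique v∈))
                   (sym (+-assoc (boolToℕ (p x)) (count p xs) (boolToℕ (p′ v)))))

module Survival {n} (G : Graph n) (d : ∀ g → Dec (HasStrongCycle G g)) where

  survives : Valuation n → List (Fin n) → Bool
  survives g s = does (all? (λ p → ¬? (d (run G g p))) (inits s))

  survivors≡count : ∀ g t → survivors G g d t ≡ count (survives g) (sequences n t)
  survivors≡count g t = length-filter≡count (λ s → all? (λ p → ¬? (d (run G g p))) (inits s)) (sequences n t)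

  survives-∷ : ∀ g v s → survives g (v ∷ s) ≡ not (does (d g)) ∧ survives (update G g v) s
  survives-∷ g v s = cong (not (does (d g)) ∧_) (does-all?-map (λ p → ¬? (d (run G g p))) (v ∷_) (inits s))

  survivors-strong : ∀ {g} → HasStrongCycle G g → ∀ t → survivors G g d t ≡ 0
  survivors-strong {g} sc t = trans (survivors≡count g t) (sum-map-zero dies (sequences n t))
    where
    dies : ∀ s → boolToℕ (survives g s) ≡ 0
    dies s rewrite dec-true (d g) sc = refl

  survivors-zero : ∀ {g} → ¬ HasStrongCycle G g → survivors G g d 0 ≡ 1
  survivors-zero {g} nsc rewrite dec-false (d g) nsc = refl

  survivors-suc : ∀ {g} → ¬ HasStrongCycle G g → ∀ t →
    survivors G g d (suc t) ≡ ∑ (λ v → survivors G (update G g v) d t)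
  survivors-suc {g} nsc t = begin
    survivors G g d (suc t)
      ≡⟨ survivors≡count g (suc t) ⟩
    count (survives g) (concatMap (λ v → map (v ∷_) (sequences n t)) (allFin n))
      ≡⟨ sum-map-concatMap (boolToℕ ∘ survives g) (λ v → map (v ∷_) (sequences n t)) (allFin n) ⟩
    ∑ (λ v → count (survives g) (map (v ∷_) (sequences n t)))
      ≡⟨ sum-map-cong (λ v → cong sum (sym (map-∘ (sequences n t)))) (allFin n) ⟩
    ∑ (λ v → count (survives g ∘ (v ∷_)) (sequences n t))
      ≡⟨ sum-map-cong (λ v → sum-map-cong (cong boolToℕ ∘ survives-step v) (sequences n t)) (allFin n) ⟩
    ∑ (λ v → count (survives (update G g v)) (sequences n t))
      ≡⟨ sum-map-cong (λ v → sym (survivors≡count (update G g v) t)) (allFin n) ⟩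
    ∑ (λ v → survivors G (update G g v) d t)
      ∎
    where
    open ≡-Reasoning
    survives-step : ∀ v s → survives g (v ∷ s) ≡ survives (update G g v) s
    survives-step v s rewrite survives-∷ g v s | dec-false (d g) nsc = refl

  S : Valuation n → ℕ → ℕ
  S g T = scaledPartialExpectation G g d T

  S-strong : ∀ {g} → HasStrongCycle G g → ∀ T → S g T ≡ 0
  S-strong sc T = sum-map-zero (λ t → cong (_* n ^ (T ∸ t)) (survivors-strong sc t)) (upTo T)

  S-suc : ∀ {g} → ¬ HasStrongCycle G g → ∀ T →
    S g (suc T) ≡ n ^ suc T + ∑ (λ v → S (update G g v) T)
  S-suc {g} nsc T = begin
    S g (suc T)
      ≡⟨ cong (λ xs → survivors G g d 0 * n ^ suc T + sum xs)
              (trans (cong (map _) (sym (map-applyUpTo id suc T))) (sym (map-∘ (upTo T)))) ⟩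
    survivors G g d 0 * n ^ suc T + sum (map (λ t → survivors G g d (suc t) * n ^ (T ∸ t)) (upTo T))
      ≡⟨ cong₂ _+_ (trans (cong (_* n ^ suc T) (survivors-zero nsc)) (*-identityˡ _))
                   (sum-map-cong (λ t → trans (cong (_* n ^ (T ∸ t)) (survivors-suc nsc t))
                                              (sym (sum-map-*ʳ (survivor t) (n ^ (T ∸ t)) (allFin n))))
                                 (upTo T)) ⟩
    n ^ suc T + sum (map (λ t → ∑ (λ v → survivor t v * n ^ (T ∸ t))) (upTo T))
      ≡⟨ cong (n ^ suc T +_) (sum-map-swap (λ v t → survivor t v * n ^ (T ∸ t)) (allFin n) (upTo T)) ⟩
    n ^ suc T + ∑ (λ v → S (update G g v) T)
      ∎
    where
    open ≡-Reasoning
    survivor : ℕ → Fin n → ℕ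
    survivor t v = survivors G (update G g v) d t

-- Optional stopping for a family of potentials: the invariant is  S g T + q i g · n^T ≤ A · n^T,
-- and an index whose potential has dropped to 0 is replaced by one that is positive.
module PotentialBound {n} (G : Graph n) (d : ∀ g → Dec (HasStrongCycle G g))
  {I : Set} (q : I → Valuation n → ℕ) (A : ℕ)
  (q≤A : ∀ i g → q i g ≤ A)
  (positive-somewhere : ∀ g → ∃ λ i → 0 < q i g)
  (drift : ∀ i g → 0 < q i g → ¬ HasStrongCycle G g →
           n * suc (q i g) ≤ ∑ (λ v → q i (update G g v)))
  where
  open Survival G d

  invariant-positive : ∀ T i g → 0 < q i g → S g T + q i g * n ^ T ≤ A * n ^ T
  bound : ∀ T g → S g T ≤ A * n ^ T
  invariant : ∀ T i g → S g T + q i g * n ^ T ≤ A * n ^ T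
  invariant-step : ∀ T i g → 0 < q i g → ¬ HasStrongCycle G g →
                   S g (suc T) + q i g * n ^ suc T ≤ A * n ^ suc T

  invariant-positive zero i g _ = *-monoˡ-≤ 1 (q≤A i g)
  invariant-positive (suc T) i g pos = decide (d g)
    where
    decide : Dec (HasStrongCycle G g) → S g (suc T) + q i g * n ^ suc T ≤ A * n ^ suc T
    decide (yes sc) = subst (λ s → s + q i g * n ^ suc T ≤ A * n ^ suc T) (sym (S-strong sc (suc T)))
                            (*-monoˡ-≤ (n ^ suc T) (q≤A i g))
    decide (no nsc) = invariant-step T i g pos nsc

  invariant-step T i g pos nsc = begin
    S g (suc T) + q i g * n ^ suc T
      ≡⟨ cong (_+ q i g * n ^ suc T) (S-suc nsc T) ⟩
    n ^ suc T + ∑ (λ v → S (g′ v) T) + q i g * n ^ suc T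
      ≡⟨ rearrange n (q i g) (n ^ T) (∑ (λ v → S (g′ v) T)) ⟩
    n * suc (q i g) * n ^ T + ∑ (λ v → S (g′ v) T)
      ≤⟨ +-monoˡ-≤ _ (*-monoˡ-≤ (n ^ T) (drift i g pos nsc)) ⟩
    ∑ (λ v → q i (g′ v)) * n ^ T + ∑ (λ v → S (g′ v) T)
      ≡⟨ cong (_+ ∑ (λ v → S (g′ v) T)) (sym (sum-map-*ʳ (q i ∘ g′) (n ^ T) (allFin n))) ⟩
    ∑ (λ v → q i (g′ v) * n ^ T) + ∑ (λ v → S (g′ v) T)
      ≡⟨ +-comm _ (∑ (λ v → S (g′ v) T)) ⟩
    ∑ (λ v → S (g′ v) T) + ∑ (λ v → q i (g′ v) * n ^ T)
      ≡⟨ sym (sum-map-+ (λ v → S (g′ v) T) (λ v → q i (g′ v) * n ^ T) (allFin n)) ⟩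
    ∑ (λ v → S (g′ v) T + q i (g′ v) * n ^ T)
      ≤⟨ sum-map-mono (λ v → invariant T i (g′ v)) (allFin n) ⟩
    ∑ {n} (λ _ → A * n ^ T)
      ≡⟨ sum-allFin-const n (A * n ^ T) ⟩
    n * (A * n ^ T)
      ≡⟨ *-comm-middle n A (n ^ T) ⟩
    A * n ^ suc T
      ∎
    where
    open ≤-Reasoning
    g′ : Fin n → Valuation n
    g′ = update G g
    rearrange : ∀ n q m s → n * m + s + q * (n * m) ≡ n * suc q * m + s
    rearrange = solve-∀
    *-comm-middle : ∀ n a m → n * (a * m) ≡ a * (n * m)
    *-comm-middle = solve-∀

  bound T g with positive-somewhere g
  ... | i , pos = ≤-trans (m≤m+n (S g T) _) (invariant-positive T i g pos)

  invariant T i g with q i g in eq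
  ... | zero  = subst (_≤ A * n ^ T) (sym (+-identityʳ (S g T))) (bound T g)
  ... | suc k = subst (λ x → S g T + x * n ^ T ≤ A * n ^ T) eq
                      (invariant-positive T i g (subst (0 <_) (sym eq) 0<1+n))

maxList-upper : ∀ {x} xs → x ∈ xs → x ≤ maxList xs
maxList-upper (y ∷ ys) (here refl) = m≤m⊔n y (maxList ys)
maxList-upper (y ∷ ys) (there x∈) = ≤-trans (maxList-upper ys x∈) (m≤n⊔m y (maxList ys))

maxList-least : ∀ {M} xs → All (_≤ M) xs → maxList xs ≤ M
maxList-least []       []         = z≤n
maxList-least (y ∷ ys) (y≤ ∷ ys≤) = ⊔-lub y≤ (maxList-least ys ys≤)

maxList-attained : ∀ (h : A → ℕ) x xs → ∃ λ y → h y ≡ maxList (map h (x ∷ xs))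
maxList-attained h x [] = x , sym (⊔-identityʳ (h x))
maxList-attained h x (y ∷ ys) with ≤-total (maxList (map h (y ∷ ys))) (h x)
... | inj₁ rest≤x = x , sym (m≥n⇒m⊔n≡m rest≤x)
... | inj₂ x≤rest with maxList-attained h y ys
...   | z , hz≡ = z , trans hz≡ (sym (m≤n⇒m⊔n≡n x≤rest))

All-map-≤ : ∀ (f : A → ℕ) {M} → (∀ x → f x ≤ M) → ∀ xs → All (_≤ M) (map f xs)
All-map-≤ f f≤ []       = []
All-map-≤ f f≤ (x ∷ xs) = f≤ x ∷ All-map-≤ f f≤ xs

module _ {n : ℕ} where

  maxVal-upper : ∀ (g : Valuation n) v → g v ≤ maxVal g
  maxVal-upper g v = maxList-upper (map g (allFin n)) (∈-map⁺ g (∈-allFin v))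

  maxVal-least : ∀ (g : Valuation n) {M} → (∀ v → g v ≤ M) → maxVal g ≤ M
  maxVal-least g g≤ = maxList-least (map g (allFin n)) (All-map-≤ g g≤ (allFin n))

  maxVal≡ : ∀ (g : Valuation n) {M} → (∀ v → g v ≤ M) → ∀ w → g w ≡ M → maxVal g ≡ M
  maxVal≡ g g≤ w gw≡M = ≤-antisym (maxVal-least g g≤) (subst (_≤ maxVal g) gw≡M (maxVal-upper g w))

maxVal-attained : ∀ {n} (g : Valuation n) → Fin n → ∃ λ v → g v ≡ maxVal g
maxVal-attained {suc _} g _ = maxList-attained g Fin.zero (tabulate Fin.suc)

module _ {n : ℕ} (G : Graph n) where

  update-≢ : ∀ (g : Valuation n) {v′ v} → v ≢ v′ → update G g v′ v ≡ g v
  update-≢ g {v′} {v} v≢v′ with v ≟ v′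
  ... | yes v≡v′ = ⊥-elim (v≢v′ v≡v′)
  ... | no _     = refl

  update-self-≤ : ∀ (g : Valuation n) {M} → (∀ u → g u ≤ M) → ∀ v → update G g v v ≤ M
  update-self-≤ g {M} g≤ v with v ≟ v
  ... | no v≢v = ⊥-elim (v≢v refl)
  ... | yes _ with outValues G g v | All-map-≤ g g≤ (filter (λ u → (G v u ∧ not ⌊ u ≟ v ⌋) Bool.≟ true) (allFin n))
  ...   | []     | _   = g≤ v
  ...   | x ∷ xs | xs≤ = maxList-least (x ∷ xs) xs≤

  update-≤ : ∀ (g : Valuation n) {M} → (∀ u → g u ≤ M) → ∀ v u → update G g v u ≤ M
  update-≤ g {M} g≤ v u = by-cases (u ≟ v)
    where
    by-cases : Dec (u ≡ v) → update G g v u ≤ M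
    by-cases (yes refl) = update-self-≤ g g≤ v
    by-cases (no u≢v)   = subst (_≤ M) (sym (update-≢ g u≢v)) (g≤ u)

  ∈-outValues : ∀ (g : Valuation n) {v w} → Edge G v w → w ≢ v → g w ∈ outValues G g v
  ∈-outValues g {v} {w} vw w≢v =
    ∈-map⁺ g (∈-filter⁺ (λ u → (G v u ∧ not ⌊ u ≟ v ⌋) Bool.≟ true) (∈-allFin w) keeps-w)
    where
    keeps-w : (G v w ∧ not ⌊ w ≟ v ⌋) ≡ true
    keeps-w with w ≟ v
    ... | yes w≡v = ⊥-elim (w≢v w≡v)
    ... | no _ rewrite vw = refl

  update-self-≥ : ∀ (g : Valuation n) {v w} → Edge G v w → w ≢ v → g w ≤ update G g v v
  update-self-≥ g {v} vw w≢v with v ≟ v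
  ... | no v≢v = ⊥-elim (v≢v refl)
  ... | yes _ with outValues G g v | ∈-outValues g vw w≢v
  ...   | []     | ()
  ...   | x ∷ xs | gw∈ = maxList-upper (x ∷ xs) gw∈

headOr : List A → A → A
headOr []      z = z
headOr (x ∷ _) z = x

-- h summed over the consecutive pairs of xs ++ [ z ]
adjSum : (A → A → ℕ) → List A → A → ℕ
adjSum h []       z = 0
adjSum h (x ∷ xs) z = h x (headOr xs z) + adjSum h xs z

Linked-uncons : {R : A → A → Set} → ∀ x xs z → Linked R (x ∷ xs ++ z ∷ []) →
                R x (headOr xs z) × Linked R (xs ++ z ∷ [])
Linked-uncons x []       z (xRz ∷ rest) = xRz , rest
Linked-uncons x (y ∷ ys) z (xRy ∷ rest) = xRy , rest

rise : (A → Bool) → A → A → ℕ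
rise p a b = boolToℕ (not (p a) ∧ p b)

fall : (A → Bool) → A → A → ℕ
fall p = rise (not ∘ p)

module _ (p : A → Bool) where

  rise-balance : ∀ a b → rise p a b + boolToℕ (p a) ≡ fall p a b + boolToℕ (p b)
  rise-balance a b with p a | p b
  ... | true  | true  = refl
  ... | true  | false = refl
  ... | false | true  = refl
  ... | false | false = refl

  adjSum-rise-telescope : ∀ xs z →
    adjSum (rise p) xs z + boolToℕ (p (headOr xs z)) ≡ adjSum (fall p) xs z + boolToℕ (p z)
  adjSum-rise-telescope []       z = refl
  adjSum-rise-telescope (x ∷ xs) z = begin
    rise p x y + adjSum (rise p) xs z + boolToℕ (p x)    ≡⟨ +-swapʳ (rise p x y) _ _ ⟩
    rise p x y + boolToℕ (p x) + adjSum (rise p) xs z    ≡⟨ cong (_+ adjSum (rise p) xs z) (rise-balance x y) ⟩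
    fall p x y + boolToℕ (p y) + adjSum (rise p) xs z    ≡⟨ +-assoc-comm (fall p x y) _ _ ⟩
    fall p x y + (adjSum (rise p) xs z + boolToℕ (p y))  ≡⟨ cong (fall p x y +_) (adjSum-rise-telescope xs z) ⟩
    fall p x y + (adjSum (fall p) xs z + boolToℕ (p z))  ≡⟨ sym (+-assoc (fall p x y) _ _) ⟩
    fall p x y + adjSum (fall p) xs z + boolToℕ (p z)    ∎
    where
    open ≡-Reasoning
    y : A
    y = headOr xs z
    +-swapʳ : ∀ a b c → a + b + c ≡ a + c + b
    +-swapʳ = solve-∀
    +-assoc-comm : ∀ a b c → a + b + c ≡ a + (c + b)
    +-assoc-comm = solve-∀

  rises≡falls : ∀ c cs → adjSum (rise p) (c ∷ cs) c ≡ adjSum (fall p) (c ∷ cs) c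
  rises≡falls c cs = +-cancelʳ-≡ (boolToℕ (p c)) _ _ (adjSum-rise-telescope (c ∷ cs) c)

  rise≡0-propagates : ∀ a b → rise p a b ≡ 0 → p b ≡ true → p a ≡ true
  rise≡0-propagates a b with p a | p b
  ... | true  | _     = λ _ _ → refl
  ... | false | true  = λ ()
  ... | false | false = λ _ ()

  no-rise⇒All : ∀ xs z → adjSum (rise p) xs z ≡ 0 → p z ≡ true → All (λ x → p x ≡ true) xs
  no-rise⇒All []       z _         _  = []
  no-rise⇒All (x ∷ xs) z no-rises pz =
    rise≡0-propagates x (headOr xs z) (m+n≡0⇒m≡0 _ no-rises) (head-true xs pxs) ∷ pxs
    where
    pxs : All (λ x → p x ≡ true) xs
    pxs = no-rise⇒All xs z (m+n≡0⇒n≡0 _ no-rises) pz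
    head-true : ∀ ys → All (λ y → p y ≡ true) ys → p (headOr ys z) ≡ true
    head-true []      []       = pz
    head-true (_ ∷ _) (py ∷ _) = py

rises-positive : (p : A → Bool) → ∀ c cs → 1 ≤ count p (c ∷ cs) → count p (c ∷ cs) < length (c ∷ cs) →
                 1 ≤ adjSum (rise p) (c ∷ cs) c
rises-positive p c cs some not-all with adjSum (rise p) (c ∷ cs) c in no-rises
... | suc _ = s≤s z≤n
... | zero  = ⊥-elim (by-cases (p c) refl)
  where
  by-cases : ∀ b → p c ≡ b → ⊥
  by-cases true  pc = <-irrefl (All⇒count≡length p (c ∷ cs) (no-rise⇒All p (c ∷ cs) c no-rises pc)) not-all
  by-cases false pc = <-irrefl (sym (All-not⇒count≡0 p (c ∷ cs) all-low)) some
    where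
    all-low : All (λ x → not (p x) ≡ true) (c ∷ cs)
    all-low = no-rise⇒All (not ∘ p) (c ∷ cs) c (trans (sym (rises≡falls p c cs)) no-rises) (cong not pc)

δ : ∀ {n} → Fin n → Fin n → ℕ
δ Fin.zero    Fin.zero    = 1
δ Fin.zero    (Fin.suc _) = 0
δ (Fin.suc _) Fin.zero    = 0
δ (Fin.suc a) (Fin.suc b) = δ a b

δ-refl : ∀ {n} (a : Fin n) → δ a a ≡ 1
δ-refl Fin.zero    = refl
δ-refl (Fin.suc a) = δ-refl a

δ-≢ : ∀ {n} {a b : Fin n} → a ≢ b → δ a b ≡ 0
δ-≢ {a = Fin.zero}  {Fin.zero}  a≢b = ⊥-elim (a≢b refl)
δ-≢ {a = Fin.zero}  {Fin.suc _} _   = refl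
δ-≢ {a = Fin.suc _} {Fin.zero}  _   = refl
δ-≢ {a = Fin.suc _} {Fin.suc _} a≢b = δ-≢ (a≢b ∘ cong Fin.suc)

sum-δ : ∀ {n} (a : Fin n) → ∑ (δ a) ≡ 1
sum-δ {n} a = trans (cong sum (map-tabulate id (δ a))) (sum-tabulate-δ a)
  where
  sum-tabulate-δ : ∀ {m} (a : Fin m) → sum (tabulate (δ a)) ≡ 1
  sum-tabulate-δ {suc m} Fin.zero    = cong suc (trans (cong sum (sym (map-tabulate {n = m} id (λ _ → 0))))
                                                       (sum-map-zero (λ _ → refl) (allFin m)))
  sum-tabulate-δ {suc m} (Fin.suc a) = sum-tabulate-δ a

module _ {n : ℕ} where

  adjSumAt : Fin n → (Fin n → Fin n → ℕ) → List (Fin n) → Fin n → ℕ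
  adjSumAt v h = adjSum (λ a b → δ a v * h a b)

  sum-adjSumAt : ∀ h xs z → ∑ (λ v → adjSumAt v h xs z) ≡ adjSum h xs z
  sum-adjSumAt h []       z = sum-map-zero (λ _ → refl) (allFin n)
  sum-adjSumAt h (x ∷ xs) z = begin
    sum (map (λ v → δ x v * h x y + adjSumAt v h xs z) (allFin n))
      ≡⟨ sum-map-+ (λ v → δ x v * h x y) (λ v → adjSumAt v h xs z) (allFin n) ⟩
    sum (map (λ v → δ x v * h x y) (allFin n)) + sum (map (λ v → adjSumAt v h xs z) (allFin n))
      ≡⟨ cong₂ _+_ (trans (sum-map-*ʳ (δ x) (h x y) (allFin n)) (trans (cong (_* h x y) (sum-δ x)) (*-identityˡ _)))
                   (sum-adjSumAt h xs z) ⟩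
    h x y + adjSum h xs z
      ∎
    where
    open ≡-Reasoning
    y : Fin n
    y = headOr xs z

  adjSumAt-∉ : ∀ {v} h xs z → v ∉ xs → adjSumAt v h xs z ≡ 0
  adjSumAt-∉ h []       z _   = refl
  adjSumAt-∉ h (x ∷ xs) z v∉ =
    cong₂ _+_ (cong (_* _) (δ-≢ (λ x≡v → v∉ (here (sym x≡v))))) (adjSumAt-∉ h xs z (v∉ ∘ there))

  adjSumAt-∈ : ∀ {R : Fin n → Fin n → Set} {v} xs z → Unique xs → v ∈ xs → Linked R (xs ++ z ∷ []) →
               ∃ λ w → R v w × (∀ h → adjSumAt v h xs z ≡ h v w)
  adjSumAt-∈ (x ∷ xs) z (x∉xs ∷ _) (here refl) linked with Linked-uncons x xs z linked
  ... | xRy , _ = headOr xs z , xRy , λ h → trans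
    (cong₂ _+_ (trans (cong (_* h x (headOr xs z)) (δ-refl x)) (*-identityˡ _))
               (adjSumAt-∉ h xs z (λ x∈ → All.lookup x∉xs x∈ refl)))
    (+-identityʳ _)
  adjSumAt-∈ {v = v} (x ∷ xs) z (x∉xs ∷ unique) (there v∈) linked with Linked-uncons x xs z linked
  ... | _ , linked′ with adjSumAt-∈ xs z unique v∈ linked′
  ...   | w , vRw , at-v = w , vRw , λ h →
    trans (cong (_+ adjSumAt v h xs z) (cong (_* h x (headOr xs z)) (δ-≢ (All.lookup x∉xs v∈)))) (at-v h)

-- x and y count the marked vertices of a cycle before and after one vertex is updated; the indices
-- are the numbers of rises and falls of the cycle that start at the updated vertex.
data Step (x y : ℕ) : ℕ → ℕ → Set where
  level : x ≤ y     → Step x y 0 0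
  up    : suc x ≤ y → Step x y 1 0
  down  : x ≤ suc y → Step x y 0 1

Step-classify : ∀ x y (a b a′ : Bool) → y + boolToℕ a ≡ x + boolToℕ a′ → (b ≡ true → a′ ≡ true) →
                Step x y (boolToℕ (not a ∧ b)) (boolToℕ (not (not a) ∧ not b))
Step-classify x y true  true  a′ balance b⇒a′ rewrite b⇒a′ refl =
  level (≤-reflexive (sym (+-cancelʳ-≡ 1 y x balance)))
Step-classify x y false true  a′ balance b⇒a′ rewrite b⇒a′ refl =
  up (≤-reflexive (trans (+-comm 1 x) (trans (sym balance) (+-identityʳ y))))
Step-classify x y true  false a′ balance _ =
  down (≤-trans (m≤m+n x (boolToℕ a′)) (≤-reflexive (trans (sym balance) (+-comm y 1))))
Step-classify x y false false a′ balance _ =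
  level (≤-trans (m≤m+n x (boolToℕ a′)) (≤-reflexive (trans (sym balance) (+-identityʳ y))))

Step-square : ∀ m y U D → Step (suc m) y U D →
  suc m * suc m + U * (suc (suc m) * suc (suc m)) + D * (m * m) ≤ y * y + U * (suc m * suc m) + D * (suc m * suc m)
Step-square m y .0 .0 (level x≤y) = +-mono-≤ (+-mono-≤ (*-mono-≤ x≤y x≤y) ≤-refl) ≤-refl
Step-square m y .1 .0 (up x<y) =
  subst₂ _≤_ (sym (swap-up (suc m * suc m) _)) (sym (pad-up (y * y) _)) (+-monoˡ-≤ (suc m * suc m) (*-mono-≤ x<y x<y))
  where
  swap-up : ∀ a b → a + 1 * b + 0 ≡ b + a
  swap-up = solve-∀
  pad-up : ∀ a b → a + 1 * b + 0 ≡ a + b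
  pad-up = solve-∀
Step-square m y .0 .1 (down x≤y+1) =
  subst₂ _≤_ (sym (swap-down (suc m * suc m) (m * m))) (sym (pad-down (y * y) (suc m * suc m)))
         (+-monoˡ-≤ (suc m * suc m) (*-mono-≤ m≤y m≤y))
  where
  m≤y : m ≤ y
  m≤y = ≤-pred x≤y+1
  swap-down : ∀ a b → a + 0 + 1 * b ≡ b + a
  swap-down = solve-∀
  pad-down : ∀ a b → a + 0 + 1 * b ≡ a + b
  pad-down = solve-∀

-- Convexity:  (x + 1)² + (x − 1)² = 2x² + 2.
sum-Step-square : ∀ {n x} (y U D : Fin n → ℕ) → 1 ≤ x → (∀ v → Step x (y v) (U v) (D v)) →
                  ∑ U ≡ ∑ D → 1 ≤ ∑ U → n * (x * x) + 1 ≤ ∑ (λ v → y v * y v)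
sum-Step-square {n} {suc m} y U D _ steps balanced rising = ≤-trans (+-monoʳ-≤ N 1≤2t) (+-cancelʳ-≤ (t * x² + t * x²) (N + 2 * t) (∑ (λ v → y v * y v)) (begin
  N + 2 * t + (t * x² + t * x²)
    ≡⟨ regroup N t m ⟩
  N + t * ((suc (suc m)) * (suc (suc m))) + t * (m * m)
    ≡⟨ sym (cong₂ (λ a b → a + t * ((suc (suc m)) * (suc (suc m))) + b * (m * m)) (sum-allFin-const n x²) (sym balanced)) ⟩
  ∑ {n} (λ _ → x²) + ∑ U * ((suc (suc m)) * (suc (suc m))) + ∑ D * (m * m)
    ≡⟨ sym (sum-map-+-*ʳ (λ _ → x²) U D _ _ (allFin n)) ⟩
  ∑ (λ v → x² + U v * (suc (suc m) * suc (suc m)) + D v * (m * m))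
    ≤⟨ sum-map-mono (λ v → Step-square m (y v) (U v) (D v) (steps v)) (allFin n) ⟩
  ∑ (λ v → y v * y v + U v * x² + D v * x²)
    ≡⟨ sum-map-+-*ʳ (λ v → y v * y v) U D x² x² (allFin n) ⟩
  ∑ (λ v → y v * y v) + t * x² + ∑ D * x²
    ≡⟨ cong (λ s → ∑ (λ v → y v * y v) + t * x² + s * x²) (sym balanced) ⟩
  ∑ (λ v → y v * y v) + t * x² + t * x²
    ≡⟨ +-assoc (∑ (λ v → y v * y v)) _ _ ⟩
  ∑ (λ v → y v * y v) + (t * x² + t * x²)
    ∎))
  where
  open ≤-Reasoning
  x² N t : ℕ
  x² = suc m * suc m
  N  = n * x²
  t  = ∑ U
  1≤2t : 1 ≤ 2 * t
  1≤2t = ≤-trans rising (m≤m+n t _)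
  regroup : ∀ N t m → N + 2 * t + (t * (suc m * suc m) + t * (suc m * suc m))
                      ≡ N + t * (suc (suc m) * suc (suc m)) + t * (m * m)
  regroup = solve-∀

-- p marks the vertices of maximal value and p′ v the same after v has been updated.
module CycleDrift {n} {R : Fin n → Fin n → Set} (p : Fin n → Bool) (p′ : Fin n → Fin n → Bool)
  (p′-off : ∀ v c → c ≢ v → p′ v c ≡ p c)
  (p′-self : ∀ {v w} → R v w → p w ≡ true → p′ v v ≡ true)
  (c : Fin n) (cs : List (Fin n)) (unique : Unique (c ∷ cs)) (linked : Linked R (c ∷ cs ++ c ∷ []))
  where

  open import Data.List.Membership.DecPropositional (_≟_ {n}) using (_∈?_)

  vertexStep : ∀ v → Step (count p (c ∷ cs)) (count (p′ v) (c ∷ cs))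
                    (adjSumAt v (rise p) (c ∷ cs) c) (adjSumAt v (fall p) (c ∷ cs) c)
  vertexStep v with v ∈? (c ∷ cs)
  ... | no v∉ = subst₂ (Step _ _) (sym (adjSumAt-∉ (rise p) (c ∷ cs) c v∉)) (sym (adjSumAt-∉ (fall p) (c ∷ cs) c v∉))
                       (level (≤-reflexive (sym (count-agree-∉ (p′-off v) (c ∷ cs) v∉))))
  ... | yes v∈ with adjSumAt-∈ (c ∷ cs) c unique v∈ linked
  ...   | w , vRw , at-v = subst₂ (Step _ _) (sym (at-v (rise p))) (sym (at-v (fall p)))
                                  (Step-classify _ _ (p v) (p w) (p′ v v)
                                     (count-agree-∈ (p′-off v) (c ∷ cs) unique v∈) (p′-self vRw))

  drift : 1 ≤ count p (c ∷ cs) → count p (c ∷ cs) < length (c ∷ cs) →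
          n * (count p (c ∷ cs) * count p (c ∷ cs)) + 1 ≤ ∑ (λ v → count (p′ v) (c ∷ cs) * count (p′ v) (c ∷ cs))
  drift some not-all =
    sum-Step-square (λ v → count (p′ v) (c ∷ cs)) (λ v → adjSumAt v (rise p) (c ∷ cs) c)
                    (λ v → adjSumAt v (fall p) (c ∷ cs) c) some vertexStep
                    (trans (sum-adjSumAt (rise p) (c ∷ cs) c) (trans (rises≡falls p c cs) (sym (sum-adjSumAt (fall p) (c ∷ cs) c))))
                    (subst (1 ≤_) (sym (sum-adjSumAt (rise p) (c ∷ cs) c)) (rises-positive p c cs some not-all))

≡ᵇ-true⇒≡ : ∀ a b → (a ≡ᵇ b) ≡ true → a ≡ b
≡ᵇ-true⇒≡ a b eq = ≡ᵇ⇒≡ a b (Equivalence.from T-≡ eq)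

≡⇒≡ᵇ-true : ∀ a b → a ≡ b → (a ≡ᵇ b) ≡ true
≡⇒≡ᵇ-true a b eq = Equivalence.to T-≡ (≡⇒≡ᵇ a b eq)

atLevel : ∀ {n} → ℕ → Valuation n → Fin n → Bool
atLevel M g c = g c ≡ᵇ M

count-atLevel≤count-atMax : ∀ {n} (g : Valuation n) {M} → (∀ u → g u ≤ M) → ∀ C →
                            count (atLevel M g) C ≤ count (atLevel (maxVal g) g) C
count-atLevel≤count-atMax g {M} g≤M = count-mono at-M⇒at-max
  where
  at-M⇒at-max : ∀ u → atLevel M g u ≡ true → atLevel (maxVal g) g u ≡ true
  at-M⇒at-max u at-M = ≡⇒≡ᵇ-true (g u) _ (trans gu≡M (sym (maxVal≡ g g≤M u gu≡M)))
    where
    gu≡M : g u ≡ M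
    gu≡M = ≡ᵇ-true⇒≡ (g u) M at-M

count-atMax<length : ∀ {n} {G : Graph n} {g : Valuation n} → ¬ HasStrongCycle G g →
                     ∀ C → IsCycle G C → count (atLevel (maxVal g) g) C < length C
count-atMax<length {g = g} no-strong C isCycle with m≤n⇒m<n∨m≡n (count-≤-length (atLevel (maxVal g) g) C)
... | inj₁ x<k = x<k
... | inj₂ x≡k = ⊥-elim (no-strong (C , isCycle ,
                   All.map (λ {v} → ≡ᵇ-true⇒≡ (g v) (maxVal g)) (count≡length⇒All (atLevel (maxVal g) g) C x≡k)))

module MaximalCycles {n} (G : Graph n) (loopless : Loopless G) (b : ℕ) (orbit : IsOrbit G b) where

  ShortCycle : Set
  ShortCycle = ∃ λ C → IsCycle G C × length C ≤ b

  maxCount : ShortCycle → Valuation n → ℕ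
  maxCount (C , _) g = count (atLevel (maxVal g) g) C

  potential : ShortCycle → Valuation n → ℕ
  potential C g = n * (maxCount C g * maxCount C g)

  potential≤ : ∀ C g → potential C g ≤ n * (b * b)
  potential≤ C@(cycle , _ , short) g = *-monoʳ-≤ n (*-mono-≤ x≤b x≤b)
    where
    x≤b : maxCount C g ≤ b
    x≤b = ≤-trans (count-≤-length (atLevel (maxVal g) g) cycle) short

  potential-positive-somewhere : ∀ g → ∃ λ C → 0 < potential C g
  potential-positive-somewhere g with maxVal-attained g (proj₁ (proj₂ orbit))
  ... | v , gv≡max with proj₁ orbit v
  ...   | _ , ((cycle , isCycle , v∈ , refl) , _) , short =
    (cycle , isCycle , short) , *-mono-≤ (inhabited v) (*-mono-≤ x≥1 x≥1)
    where
    inhabited : Fin n → 1 ≤ n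
    inhabited Fin.zero    = s≤s z≤n
    inhabited (Fin.suc _) = s≤s z≤n
    x≥1 : 1 ≤ count (atLevel (maxVal g) g) cycle
    x≥1 = count-positive (atLevel (maxVal g) g) cycle v∈ (≡⇒≡ᵇ-true (g v) (maxVal g) gv≡max)

  edge-≢ : ∀ {v w} → Edge G v w → w ≢ v
  edge-≢ {v} vw refl with trans (sym vw) (loopless v)
  ... | ()

  update-at-max-successor : ∀ g {v w} → Edge G v w → g w ≡ maxVal g → update G g v v ≡ maxVal g
  update-at-max-successor g {v} vw gw≡max = ≤-antisym (update-self-≤ G g (maxVal-upper g) v)
    (subst (_≤ update G g v v) gw≡max (update-self-≥ G g vw (edge-≢ vw)))

  potential-drift : ∀ C g → 0 < potential C g → ¬ HasStrongCycle G g →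
                    n * suc (potential C g) ≤ ∑ (λ v → potential C (update G g v))
  potential-drift ([] , () , _)
  potential-drift C@(c ∷ cs , isCycle@(unique , linked) , _) g pos no-strong = begin
    n * suc (n * (x * x))         ≡⟨ cong (n *_) (+-comm 1 (n * (x * x))) ⟩
    n * (n * (x * x) + 1)         ≤⟨ *-monoʳ-≤ n (Drift.drift x≥1 (count-atMax<length no-strong (c ∷ cs) isCycle)) ⟩
    n * ∑ (λ v → y v * y v)       ≡⟨ sym (sum-map-*ˡ n (λ v → y v * y v) (allFin n)) ⟩
    ∑ (λ v → n * (y v * y v))     ≤⟨ sum-map-mono (λ v → *-monoʳ-≤ n (*-mono-≤ (y≤ v) (y≤ v))) (allFin n) ⟩
    ∑ (λ v → potential C (update G g v)) ∎
    where
    open ≤-Reasoning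
    M : ℕ
    M = maxVal g
    module Drift = CycleDrift (atLevel M g) (λ v → atLevel M (update G g v))
      (λ v c c≢v → cong (_≡ᵇ M) (update-≢ G g c≢v))
      (λ {v} {w} vw w-max → ≡⇒≡ᵇ-true _ M (update-at-max-successor g vw (≡ᵇ-true⇒≡ (g w) M w-max)))
      c cs unique linked
    x : ℕ
    x = count (atLevel M g) (c ∷ cs)
    y : Fin n → ℕ
    y v = count (atLevel M (update G g v)) (c ∷ cs)
    x≥1 : 1 ≤ x
    x≥1 with x
    ... | zero  = ⊥-elim (<-irrefl (sym (*-zeroʳ n)) pos)
    ... | suc _ = s≤s z≤n
    y≤ : ∀ v → y v ≤ maxCount C (update G g v)
    y≤ v = count-atLevel≤count-atMax (update G g v) (update-≤ G g (maxVal-upper g) v) (c ∷ cs)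

scaledPartialExpectation≤ : ∀ {n} (G : Graph n) → Loopless G → ∀ b → IsOrbit G b →
  (d : ∀ g → Dec (HasStrongCycle G g)) (f : Valuation n) (T : ℕ) →
  scaledPartialExpectation G f d T ≤ n * (b * b) * n ^ T
scaledPartialExpectation≤ {n} G loopless b orbit d f T =
  PotentialBound.bound G d potential (n * (b * b)) potential≤ potential-positive-somewhere potential-drift T f
  where open MaximalCycles G loopless b orbit

mainTheorem8 : Σ ℕ (λ C → 0 < C × ((n : ℕ) (G : Graph n) → Loopless G → StronglyConnected G →
                 (b : ℕ) → IsOrbit G b → (f : Valuation n) → ValidValuation n f →
                 (d : ∀ g → Dec (HasStrongCycle G g)) → (T : ℕ) →
                 scaledPartialExpectation G f d T ≤ C * n * (b * b) * n ^ T))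
mainTheorem8 = 1 , s≤s z≤n , λ n G loopless _ b orbit f _ d T →
  subst (λ m → scaledPartialExpectation G f d T ≤ m * (b * b) * n ^ T) (sym (*-identityˡ n))
        (scaledPartialExpectation≤ G loopless b orbit d f T)
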